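{- Let $m$ be an odd positive integer. Then $$Z_{2m}(x) = Z_m(x)\, Z_m(-\Phi_2(x)) = Z_m(x)\,Z_m(4-x),$$ and for every integer $k \ge 2$ $$Z_{2^k m}(x) = Z_{2^{k-1}m}(x)\, Z_m\bigl(\Phi_{2^k}(x)\bigr).$$
   Context: The polynomials $l_n(x)$ are defined by $l_0(x)=2$, $l_1(x)=x$, $l_n(x) = xl_{n-1}(x) - l_{n-2}(x)$ for $n\ge2$, and $Z_n(x) = 2 - l_n(2-x)$ (equivalently $Z_n(x)=4S_n(x/4)$ with $S_n$ the spread polynomials). For $n\ge 1$ let $\phi_n(x)$ be the minimal polynomial over $\mathbb{Q}$ of $4\sin^2(\pi/n)$. Set $\Phi_1(x)=x$, $\Phi_2(x)=x-4$, and $\Phi_n(x)=\phi_n(x)^2$ for $n\ge 3$; these satisfy $(-1)^{n-1}Z_n(x)=\prod_{d\mid n}\Phi_d(x)$. -}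

module Defs where

open import Data.Nat as ℕ using (ℕ; zero; suc)
open import Data.Nat.Divisibility using (_∣?_)
open import Data.Integer using (ℤ; +_; _+_; _-_; _*_; -_; _^_)
open import Data.List using (List; []; _∷_; foldr; map; filter; upTo)

l : ℕ → ℤ → ℤ
l zero x = + 2
l (suc zero) x = x
l (suc (suc n)) x = x * l (suc n) x - l n x

Z : ℕ → ℤ → ℤ
Z n x = + 2 - l n (+ 2 - x)

-- Polynomials with integer coefficients, as coefficient lists (constant term first)
Poly : Set
Poly = List ℤ

eval : Poly → ℤ → ℤ
eval p x = foldr (λ a acc → a + x * acc) (+ 0) p

divisors : ℕ → List ℕ
divisors n = filter (λ d → d ∣? n) (map suc (upTo n))

prodDiv : ℕ → (ℕ → ℤ) → ℤ
prodDiv n f = foldr (λ d acc → f d * acc) (+ 1) (divisors n)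

-- The family Φ_n is characterised by Φ_1 = x, Φ_2 = x - 4 and
-- (-1)^{n-1} Z_n(x) = ∏_{d ∣ n} Φ_d(x) for all n ≥ 1 (this determines Φ uniquely).
IsPhiFamily : (ℕ → Poly) → Set
IsPhiFamily Φ =
  ((x : ℤ) → eval (Φ 1) x ≡ x) ×
  ((x : ℤ) → eval (Φ 2) x ≡ x - + 4) ×
  ((n : ℕ) → 1 ℕ.≤ n → (x : ℤ) → (- + 1) ^ (n ℕ.∸ 1) * Z n x ≡ prodDiv n (λ d → eval (Φ d) x))
  where
  open import Data.Product using (_×_)
  open import Relation.Binary.PropositionalEquality using (_≡_)

-- Put y = 2 - x, so that Z_n(x) = 2 - l_n(y). The product formula l_b l_{b+c} = l_{2b+c} + l_c
-- gives l_{nb} = l_n ∘ l_b, hence Z_{nb} = Z_n ∘ Z_b and Z_{2n} = Z_n (4 - Z_n); for odd m,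
-- l_m(-y) = -l_m(y) gives Z_m(4 - x) = 4 - Z_m(x). Therefore
-- Z_{2Nm} = Z_{Nm} (4 - Z_m(Z_N)) = Z_{Nm} Z_m(4 - Z_N), which for N = 1 is the first identity.
-- For N = 2^{k-1} with k ≥ 2, the divisors of 2N are those of N together with 2N, and the signs
-- (-1)^{N-1} and (-1)^{2N-1} are both -1, so the divisor-product identity gives Z_{2N} = Z_N Φ_{2N}.
-- Comparing with Z_{2N} = Z_N (4 - Z_N) yields Φ_{2N} = 4 - Z_N wherever Z_N ≠ 0, and where
-- Z_N(x) = 0 both sides vanish, because Z_{Nm} = Z_m ∘ Z_N and Z_m(0) = 0.

{-# OPTIONS --safe #-}
module Submission where

open import Defs
open import Data.Nat using (ℕ; _≤_; _%_; _^_) renaming (_*_ to _*ℕ_; _∸_ to _∸ℕ_)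
open import Data.Integer using (ℤ; +_; _-_; _*_; -_)
open import Data.Product using (_×_)
open import Relation.Binary.PropositionalEquality using (_≡_)

open import Data.Nat using (zero; suc; _<_; s≤s; NonZero; pred; nonTrivial⇒n>1; >-nonZero⁻¹)
  renaming (_+_ to _+ℕ_)
open import Data.Nat.Properties
  using (+-suc; +-identityʳ; *-comm; *-assoc; m+n≮m; <⇒≢; ≤-<-trans; +-monoʳ-<; m<m*n; m^n≢0; m*n≢0;
         suc-pred; m≤n⇒∃[o]m+o≡n)
open import Data.Nat.Divisibility
  using (_∣_; _∣?_; divides; ∣-trans; ∣-refl; ∣⇒≤; ∣1⇒≡1; n∣m*n; *-monoˡ-∣; *-cancelʳ-∣)
open import Data.Nat.Coprimality using (Coprime; coprime-divisor)
import Data.Nat.Coprimality as Coprime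
open import Data.Nat.Primality using (Prime; prime⇒irreducible; prime⇒nonZero; prime⇒nonTrivial; prime[2])
open import Data.Integer using (_+_; 0ℤ; 1ℤ; -1ℤ; _≟_; ≢-nonZero) renaming (_^_ to _^ℤ_)
open import Data.Integer.Properties
  using (*-identityˡ; *-identityʳ; -1*i≡-i; ^-*-assoc; ^-zeroˡ; neg-involutive)
import Data.Integer.Properties as ℤ
open import Data.Integer.Tactic.RingSolver using (solve-∀)
open import Data.List using ([]; _∷_; [_]; _++_; foldr; filter; map; upTo; applyUpTo)
open import Data.List.Properties
  using (filter-++; filter-none; filter-accept; filter-reject; foldr-++; map-upTo; applyUpTo-∷ʳ; ++-assoc)
open import Data.List.Relation.Unary.All using (All; []; _∷_)
import Data.List.Relation.Unary.All as All
open import Data.List.Relation.Unary.All.Properties using (map⁺; all-upTo; applyUpTo⁺₁)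
open import Data.Product using (_,_)
open import Data.Sum using (_⊎_; inj₁; inj₂; [_,_]′)
open import Function using (_∘_; id)
open import Relation.Nullary using (¬_; Dec; yes; no; contradiction)
open import Relation.Unary using (Pred; Decidable)
open import Relation.Binary.PropositionalEquality
  using (refl; sym; trans; cong; cong₂; subst; subst₂; module ≡-Reasoning)
open ≡-Reasoning

applyUpTo-+ : ∀ {a} {A : Set a} (f : ℕ → A) m n →
              applyUpTo f (m +ℕ n) ≡ applyUpTo f m ++ applyUpTo (f ∘ (m +ℕ_)) n
applyUpTo-+ f zero n = refl
applyUpTo-+ f (suc m) n = cong (f 0 ∷_) (applyUpTo-+ (f ∘ suc) m n)

module _ {a p} {A : Set a} {P Q : Pred A p} (P? : Decidable P) (Q? : Decidable Q) where

  filter-≐-on : ∀ {xs} → All (λ x → (P x → Q x) × (Q x → P x)) xs → filter P? xs ≡ filter Q? xs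
  filter-≐-on [] = refl
  filter-≐-on {x ∷ xs} ((P⇒Q , Q⇒P) ∷ P≐Q) with P? x
  ... | yes Px = trans (cong (x ∷_) (filter-≐-on P≐Q)) (sym (filter-accept Q? (P⇒Q Px)))
  ... | no ¬Px = trans (filter-≐-on P≐Q) (sym (filter-reject Q? (¬Px ∘ Q⇒P)))

foldr-*-init : ∀ (f : ℕ → ℤ) c xs →
               foldr (λ d acc → f d * acc) c xs ≡ foldr (λ d acc → f d * acc) 1ℤ xs * c
foldr-*-init f c [] = sym (*-identityˡ c)
foldr-*-init f c (x ∷ xs) = trans (cong (f x *_) (foldr-*-init f c xs)) (sym (ℤ.*-assoc (f x) _ c))

prime∤⇒coprime : ∀ {p n} → Prime p → ¬ p ∣ n → Coprime p n
prime∤⇒coprime p-prime p∤n (d∣p , d∣n) with prime⇒irreducible p-prime d∣p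
... | inj₁ d≡1 = d≡1
... | inj₂ refl = contradiction d∣n p∤n

∣p^[1+n]⇒∣p^n⊎≡p^[1+n] : ∀ {p d} → Prime p → ∀ n → d ∣ p ^ suc n → d ∣ p ^ n ⊎ d ≡ p ^ suc n
∣p^[1+n]⇒∣p^n⊎≡p^[1+n] {p} {d} p-prime n d∣pⁿ⁺¹ with p ∣? d
... | no p∤d = inj₁ (coprime-divisor (Coprime.sym (prime∤⇒coprime p-prime p∤d)) d∣pⁿ⁺¹)
... | yes (divides q refl) =
  cofactor n (*-cancelʳ-∣ p {{prime⇒nonZero p-prime}} (subst (q *ℕ p ∣_) (*-comm p (p ^ n)) d∣pⁿ⁺¹))
  where
  cofactor : ∀ n → q ∣ p ^ n → q *ℕ p ∣ p ^ n ⊎ q *ℕ p ≡ p ^ suc n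
  cofactor zero q∣1 = inj₂ (trans (cong (_*ℕ p) (∣1⇒≡1 q∣1)) (*-comm 1 p))
  cofactor (suc n) q∣pⁿ⁺¹ with ∣p^[1+n]⇒∣p^n⊎≡p^[1+n] p-prime n q∣pⁿ⁺¹
  ... | inj₁ q∣pⁿ = inj₁ (subst (q *ℕ p ∣_) (*-comm (p ^ n) p) (*-monoˡ-∣ p q∣pⁿ))
  ... | inj₂ q≡pⁿ⁺¹ = inj₂ (trans (cong (_*ℕ p) q≡pⁿ⁺¹) (*-comm (p ^ suc n) p))

divisors-extend : ∀ {N M} .{{_ : NonZero N}} → N < M → N ∣ M → (∀ {d} → d ∣ M → d < M → d ∣ N) →
                  divisors M ≡ divisors N ++ [ M ]
divisors-extend {N} N<M N∣M proper with k , refl ← m≤n⇒∃[o]m+o≡n N<M = begin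
  filter (_∣? M) (map suc (upTo M))                          ≡⟨ cong (filter (_∣? M)) range-split ⟩
  filter (_∣? M) (lower ++ middle ++ [ M ])                  ≡⟨ filter-++ (_∣? M) lower (middle ++ [ M ]) ⟩
  filter (_∣? M) lower ++ filter (_∣? M) (middle ++ [ M ])   ≡⟨ cong₂ _++_ lower-divisors upper-divisors ⟩
  divisors N ++ [ M ] ∎
  where
  M = suc (N +ℕ k)
  lower = map suc (upTo N)
  middle = applyUpTo (suc ∘ (N +ℕ_)) k

  range-split : map suc (upTo M) ≡ lower ++ middle ++ [ M ]
  range-split = begin
    map suc (upTo M)                      ≡⟨ map-upTo suc M ⟩
    applyUpTo suc M                       ≡⟨ applyUpTo-∷ʳ suc (N +ℕ k) ⟨
    applyUpTo suc (N +ℕ k) ++ [ M ]       ≡⟨ cong (_++ [ M ]) (applyUpTo-+ suc N k) ⟩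
    (applyUpTo suc N ++ middle) ++ [ M ]  ≡⟨ ++-assoc (applyUpTo suc N) middle [ M ] ⟩
    applyUpTo suc N ++ middle ++ [ M ]    ≡⟨ cong (_++ middle ++ [ M ]) (map-upTo suc N) ⟨
    lower ++ middle ++ [ M ] ∎

  lower-divisors : filter (_∣? M) lower ≡ filter (_∣? N) lower
  lower-divisors = filter-≐-on (_∣? M) (_∣? N) (map⁺ (All.map agree (all-upTo N)))
    where
    agree : ∀ {i} → i < N → (suc i ∣ M → suc i ∣ N) × (suc i ∣ N → suc i ∣ M)
    agree i<N = (λ 1+i∣M → proper 1+i∣M (≤-<-trans i<N N<M)) , (λ 1+i∣N → ∣-trans 1+i∣N N∣M)

  upper-divisors : filter (_∣? M) (middle ++ [ M ]) ≡ [ M ]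
  upper-divisors = trans (filter-++ (_∣? M) middle [ M ])
    (cong₂ _++_ (filter-none (_∣? M) (applyUpTo⁺₁ (suc ∘ (N +ℕ_)) k non-divisor))
                (filter-accept (_∣? M) ∣-refl))
    where
    non-divisor : ∀ {i} → i < k → ¬ suc (N +ℕ i) ∣ M
    non-divisor {i} i<k d∣M = m+n≮m N i (∣⇒≤ (proper d∣M (s≤s (+-monoʳ-< N i<k))))

prodDiv-prime-power : ∀ {p} → Prime p → ∀ n (f : ℕ → ℤ) →
                      prodDiv (p ^ suc n) f ≡ prodDiv (p ^ n) f * f (p ^ suc n)
prodDiv-prime-power {p} p-prime n f = begin
  foldr g 1ℤ (divisors (p ^ suc n))                ≡⟨ cong (foldr g 1ℤ) (divisors-extend pⁿ<pⁿ⁺¹ (n∣m*n p) proper) ⟩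
  foldr g 1ℤ (divisors (p ^ n) ++ [ p ^ suc n ])   ≡⟨ foldr-++ g 1ℤ (divisors (p ^ n)) [ p ^ suc n ] ⟩
  foldr g (f (p ^ suc n) * 1ℤ) (divisors (p ^ n))  ≡⟨ foldr-*-init f _ (divisors (p ^ n)) ⟩
  prodDiv (p ^ n) f * (f (p ^ suc n) * 1ℤ)         ≡⟨ cong (prodDiv (p ^ n) f *_) (*-identityʳ _) ⟩
  prodDiv (p ^ n) f * f (p ^ suc n) ∎
  where
  instance
    p≢0 : NonZero p
    p≢0 = prime⇒nonZero p-prime
    pⁿ≢0 : NonZero (p ^ n)
    pⁿ≢0 = m^n≢0 p n
  g : ℕ → ℤ → ℤ
  g d acc = f d * acc
  pⁿ<pⁿ⁺¹ : p ^ n < p ^ suc n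
  pⁿ<pⁿ⁺¹ = subst (p ^ n <_) (*-comm (p ^ n) p) (m<m*n (p ^ n) p (nonTrivial⇒n>1 p {{prime⇒nonTrivial p-prime}}))
  proper : ∀ {d} → d ∣ p ^ suc n → d < p ^ suc n → d ∣ p ^ n
  proper d∣pⁿ⁺¹ d<pⁿ⁺¹ = [ id , (λ d≡pⁿ⁺¹ → contradiction d≡pⁿ⁺¹ (<⇒≢ d<pⁿ⁺¹)) ]′
                           (∣p^[1+n]⇒∣p^n⊎≡p^[1+n] p-prime n d∣pⁿ⁺¹)

+-suc-suc : ∀ m n → m +ℕ suc (suc n) ≡ suc (suc (m +ℕ n))
+-suc-suc m n = trans (+-suc m (suc n)) (cong suc (+-suc m n))

l-product : ∀ b c y → l b y * l (b +ℕ c) y ≡ l (b +ℕ (b +ℕ c)) y + l c y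
l-product zero c y = double-self (l c y)
  where
  double-self : ∀ u → + 2 * u ≡ u + u
  double-self = solve-∀
l-product (suc zero) c y = sub-add (y * l (suc c) y) (l c y)
  where
  sub-add : ∀ u v → u ≡ (u - v) + v
  sub-add = solve-∀
l-product (suc (suc b)) c y = begin
  (y * l (suc b) y - l b y) * l (2 +ℕ s) y
    ≡⟨ distrib y (l (suc b) y) (l b y) (l (2 +ℕ s) y) ⟩
  y * (l (suc b) y * l (2 +ℕ s) y) - l b y * l (2 +ℕ s) y
    ≡⟨ cong₂ (λ u v → y * u - v) (reindex₁ (l-product (suc b) (suc c) y))
                                  (reindex₂ (l-product b (2 +ℕ c) y)) ⟩
  y * (l (3 +ℕ t) y + l (suc c) y) - (l (2 +ℕ t) y + (y * l (suc c) y - l c y))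
    ≡⟨ regroup y (l (3 +ℕ t) y) (l (2 +ℕ t) y) (l (suc c) y) (l c y) ⟩
  l (4 +ℕ t) y + l c y
    ≡⟨ cong (λ i → l (suc (suc i)) y + l c y) (sym (+-suc-suc b s)) ⟩
  l (2 +ℕ b +ℕ (2 +ℕ b +ℕ c)) y + l c y ∎
  where
  s = b +ℕ c
  t = b +ℕ s
  reindex₁ : l (suc b) y * l (suc (b +ℕ suc c)) y ≡ l (suc (b +ℕ suc (b +ℕ suc c))) y + l (suc c) y
           → l (suc b) y * l (2 +ℕ s) y ≡ l (3 +ℕ t) y + l (suc c) y
  reindex₁ = subst₂ (λ i j → l (suc b) y * l (suc i) y ≡ l (suc j) y + l (suc c) y)
               (+-suc b c) (trans (cong (b +ℕ_) (cong suc (+-suc b c))) (+-suc-suc b s))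
  reindex₂ : l b y * l (b +ℕ (2 +ℕ c)) y ≡ l (b +ℕ (b +ℕ (2 +ℕ c))) y + l (2 +ℕ c) y
           → l b y * l (2 +ℕ s) y ≡ l (2 +ℕ t) y + (y * l (suc c) y - l c y)
  reindex₂ = subst₂ (λ i j → l b y * l i y ≡ l j y + l (2 +ℕ c) y)
               (+-suc-suc b c) (trans (cong (b +ℕ_) (+-suc-suc b c)) (+-suc-suc b s))
  distrib : ∀ y u v w → (y * u - v) * w ≡ y * (u * w) - v * w
  distrib = solve-∀
  regroup : ∀ y u v w z → y * (u + w) - (v + (y * w - z)) ≡ (y * u - v) + z
  regroup = solve-∀

l-comp : ∀ n b y → l (n *ℕ b) y ≡ l n (l b y)
l-comp zero b y = refl
l-comp (suc zero) b y = cong (λ i → l i y) (+-identityʳ b)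
l-comp (suc (suc n)) b y = begin
  l (b +ℕ (b +ℕ n *ℕ b)) y
    ≡⟨ move-right (l-product b (n *ℕ b) y) ⟩
  l b y * l (b +ℕ n *ℕ b) y - l (n *ℕ b) y
    ≡⟨ cong₂ (λ u v → l b y * u - v) (l-comp (suc n) b y) (l-comp n b y) ⟩
  l (suc (suc n)) (l b y) ∎
  where
  move-right : ∀ {u v w} → u ≡ v + w → v ≡ u - w
  move-right {u} {v} {w} u≡v+w = trans (add-sub v w) (cong (_- w) (sym u≡v+w))
    where
    add-sub : ∀ v w → v ≡ (v + w) - w
    add-sub = solve-∀

l-neg : ∀ n y → l n (- y) ≡ -1ℤ ^ℤ n * l n y
l-neg zero y = refl
l-neg (suc zero) y = sym (-1*i≡-i y)
l-neg (suc (suc n)) y = begin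
  (- y) * l (suc n) (- y) - l n (- y)
    ≡⟨ cong₂ (λ u v → (- y) * u - v) (l-neg (suc n) y) (l-neg n y) ⟩
  (- y) * (-1ℤ * s * l (suc n) y) - s * l n y
    ≡⟨ sign-out y s (l (suc n) y) (l n y) ⟩
  -1ℤ * (-1ℤ * s) * (y * l (suc n) y - l n y) ∎
  where
  s = -1ℤ ^ℤ n
  sign-out : ∀ y s u v → (- y) * (-1ℤ * s * u) - s * v ≡ -1ℤ * (-1ℤ * s) * (y * u - v)
  sign-out = solve-∀

l-at-2 : ∀ n → l n (+ 2) ≡ + 2
l-at-2 zero = refl
l-at-2 (suc zero) = refl
l-at-2 (suc (suc n)) = cong₂ (λ u v → + 2 * u - v) (l-at-2 (suc n)) (l-at-2 n)

-1^odd : ∀ m → m % 2 ≡ 1 → -1ℤ ^ℤ m ≡ -1ℤ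
-1^odd (suc zero) _ = refl
-1^odd (suc (suc m)) m-odd = cong (λ s → -1ℤ * (-1ℤ * s)) (-1^odd m m-odd)

-1^[2n∸1] : ∀ n .{{_ : NonZero n}} → -1ℤ ^ℤ (2 *ℕ n ∸ℕ 1) ≡ -1ℤ
-1^[2n∸1] n = begin
  -1ℤ ^ℤ pred (2 *ℕ n)               ≡⟨ sym (neg-involutive _) ⟩
  - (- (-1ℤ ^ℤ pred (2 *ℕ n)))       ≡⟨ cong -_ (sym (-1*i≡-i _)) ⟩
  - (-1ℤ ^ℤ suc (pred (2 *ℕ n)))     ≡⟨ cong (λ k → - (-1ℤ ^ℤ k)) (suc-pred (2 *ℕ n) {{m*n≢0 2 n}}) ⟩
  - (-1ℤ ^ℤ (2 *ℕ n))                ≡⟨ cong -_ (sym (^-*-assoc -1ℤ 2 n)) ⟩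
  - (1ℤ ^ℤ n)                        ≡⟨ cong -_ (^-zeroˡ n) ⟩
  -1ℤ ∎

Z-comp : ∀ n b x → Z (n *ℕ b) x ≡ Z n (Z b x)
Z-comp n b x = cong (λ u → + 2 - u) (trans (l-comp n b (+ 2 - x)) (cong (l n) (sym (2-[2-u] (l b (+ 2 - x))))))
  where
  2-[2-u] : ∀ u → + 2 - (+ 2 - u) ≡ u
  2-[2-u] = solve-∀

Z-at-0 : ∀ n → Z n 0ℤ ≡ 0ℤ
Z-at-0 n = cong (λ u → + 2 - u) (l-at-2 n)

Z-double : ∀ n x → Z (2 *ℕ n) x ≡ Z n x * (+ 4 - Z n x)
Z-double n x = trans (cong (λ u → + 2 - u) (l-comp 2 n (+ 2 - x))) (factor (l n (+ 2 - x)))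
  where
  factor : ∀ w → + 2 - (w * w - + 2) ≡ (+ 2 - w) * (+ 4 - (+ 2 - w))
  factor = solve-∀

Z-odd-reflect : ∀ m → m % 2 ≡ 1 → ∀ x → Z m (+ 4 - x) ≡ + 4 - Z m x
Z-odd-reflect m m-odd x = begin
  + 2 - l m (+ 2 - (+ 4 - x))   ≡⟨ cong (λ y → + 2 - l m y) (reflect x) ⟩
  + 2 - l m (- (+ 2 - x))       ≡⟨ cong (λ u → + 2 - u) (l-neg m (+ 2 - x)) ⟩
  + 2 - -1ℤ ^ℤ m * l m (+ 2 - x) ≡⟨ cong (λ s → + 2 - s * l m (+ 2 - x)) (-1^odd m m-odd) ⟩
  + 2 - -1ℤ * l m (+ 2 - x)     ≡⟨ regroup (l m (+ 2 - x)) ⟩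
  + 4 - Z m x ∎
  where
  reflect : ∀ x → + 2 - (+ 4 - x) ≡ - (+ 2 - x)
  reflect = solve-∀
  regroup : ∀ w → + 2 - -1ℤ * w ≡ + 4 - (+ 2 - w)
  regroup = solve-∀

Z-lift-cofactor : ∀ N m x {w} → m % 2 ≡ 1 → Z (2 *ℕ N) x ≡ Z N x * w →
                  Z (2 *ℕ N *ℕ m) x ≡ Z (N *ℕ m) x * Z m w
Z-lift-cofactor N m x {w} m-odd Z[2N]≡Z[N]*w = begin
  Z (2 *ℕ N *ℕ m) x                   ≡⟨ cong (λ n → Z n x) (*-assoc 2 N m) ⟩
  Z (2 *ℕ (N *ℕ m)) x                 ≡⟨ Z-double (N *ℕ m) x ⟩
  Z (N *ℕ m) x * (+ 4 - Z (N *ℕ m) x) ≡⟨ cofactor (Z N x ≟ 0ℤ) ⟩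
  Z (N *ℕ m) x * Z m w ∎
  where
  Z[Nm]≡Z[m]∘Z[N] : Z (N *ℕ m) x ≡ Z m (Z N x)
  Z[Nm]≡Z[m]∘Z[N] = trans (cong (λ n → Z n x) (*-comm N m)) (Z-comp m N x)
  cofactor : Dec (Z N x ≡ 0ℤ) → Z (N *ℕ m) x * (+ 4 - Z (N *ℕ m) x) ≡ Z (N *ℕ m) x * Z m w
  cofactor (yes Z[N]≡0) rewrite Z[Nm]≡Z[m]∘Z[N] | Z[N]≡0 | Z-at-0 m = refl
  cofactor (no Z[N]≢0) = cong (Z (N *ℕ m) x *_) (begin
    + 4 - Z (N *ℕ m) x    ≡⟨ cong (λ u → + 4 - u) Z[Nm]≡Z[m]∘Z[N] ⟩
    + 4 - Z m (Z N x)     ≡⟨ Z-odd-reflect m m-odd (Z N x) ⟨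
    Z m (+ 4 - Z N x)     ≡⟨ cong (Z m) w≡4-Z[N] ⟨
    Z m w ∎)
    where
    w≡4-Z[N] : w ≡ + 4 - Z N x
    w≡4-Z[N] = ℤ.*-cancelˡ-≡ (Z N x) w (+ 4 - Z N x) {{≢-nonZero Z[N]≢0}}
                 (trans (sym Z[2N]≡Z[N]*w) (Z-double N x))

Z-split-at-2-power : ∀ x (f : ℕ → ℤ) → (∀ n → 1 ≤ n → -1ℤ ^ℤ (n ∸ℕ 1) * Z n x ≡ prodDiv n f) →
                     ∀ a → Z (2 *ℕ 2 ^ suc a) x ≡ Z (2 ^ suc a) x * f (2 *ℕ 2 ^ suc a)
Z-split-at-2-power x f factorisation a = begin
  Z (2 *ℕ N) x                  ≡⟨ neg-involutive _ ⟨
  - (- Z (2 *ℕ N) x)            ≡⟨ cong -_ (neg-Z[2n] N {{m^n≢0 2 (suc a)}}) ⟩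
  - prodDiv (2 *ℕ N) f          ≡⟨ cong -_ (prodDiv-prime-power prime[2] (suc a) f) ⟩
  - (prodDiv N f * f (2 *ℕ N))  ≡⟨ cong (λ P → - (P * f (2 *ℕ N))) (neg-Z[2n] (2 ^ a) {{m^n≢0 2 a}}) ⟨
  - (- Z N x * f (2 *ℕ N))      ≡⟨ neg-neg-* (Z N x) (f (2 *ℕ N)) ⟩
  Z N x * f (2 *ℕ N) ∎
  where
  N = 2 ^ suc a
  neg-Z[2n] : ∀ n .{{_ : NonZero n}} → - Z (2 *ℕ n) x ≡ prodDiv (2 *ℕ n) f
  neg-Z[2n] n = begin
    - Z (2 *ℕ n) x                       ≡⟨ -1*i≡-i _ ⟨
    -1ℤ * Z (2 *ℕ n) x                   ≡⟨ cong (_* Z (2 *ℕ n) x) (-1^[2n∸1] n) ⟨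
    -1ℤ ^ℤ (2 *ℕ n ∸ℕ 1) * Z (2 *ℕ n) x  ≡⟨ factorisation (2 *ℕ n) (>-nonZero⁻¹ (2 *ℕ n) {{m*n≢0 2 n}}) ⟩
    prodDiv (2 *ℕ n) f ∎
  neg-neg-* : ∀ u v → - (- u * v) ≡ u * v
  neg-neg-* = solve-∀

theorem3 : (Φ : ℕ → Poly) → IsPhiFamily Φ →
    (m : ℕ) → m % 2 ≡ 1 →
    ((x : ℤ) → (Z (2 *ℕ m) x ≡ Z m x * Z m (- eval (Φ 2) x))
                × (Z (2 *ℕ m) x ≡ Z m x * Z m (+ 4 - x)))
    × ((k : ℕ) → 2 ≤ k → (x : ℤ) →
         Z (2 ^ k *ℕ m) x ≡ Z (2 ^ (k ∸ℕ 1) *ℕ m) x * Z m (eval (Φ (2 ^ k)) x))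
theorem3 Φ (_ , Φ₂ , Φ-factorisation) m m-odd = k≡1 , k≥2
  where
  Z[2m] : ∀ x → Z (2 *ℕ m) x ≡ Z m x * Z m (+ 4 - x)
  Z[2m] x = trans (Z-double m x) (cong (Z m x *_) (sym (Z-odd-reflect m m-odd x)))

  k≡1 : ∀ x → (Z (2 *ℕ m) x ≡ Z m x * Z m (- eval (Φ 2) x)) × (Z (2 *ℕ m) x ≡ Z m x * Z m (+ 4 - x))
  k≡1 x = trans (Z[2m] x) (cong (λ t → Z m x * Z m t) (sym -Φ₂≡4-x)) , Z[2m] x
    where
    -Φ₂≡4-x : - eval (Φ 2) x ≡ + 4 - x
    -Φ₂≡4-x = trans (cong -_ (Φ₂ x)) (neg-[x-4] x)
      where
      neg-[x-4] : ∀ x → - (x - + 4) ≡ + 4 - x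
      neg-[x-4] = solve-∀

  k≥2 : ∀ k → 2 ≤ k → ∀ x → Z (2 ^ k *ℕ m) x ≡ Z (2 ^ (k ∸ℕ 1) *ℕ m) x * Z m (eval (Φ (2 ^ k)) x)
  k≥2 (suc zero) (s≤s ())
  k≥2 (suc (suc a)) _ x = Z-lift-cofactor (2 ^ suc a) m x m-odd
    (Z-split-at-2-power x (λ d → eval (Φ d) x) (λ n 1≤n → Φ-factorisation n 1≤n x) a)
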